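{- Let $d\ge1$ and let $\Delta$ be a $d$-dimensional simplicial complex with $f_d(\Delta)=s$. Then $\mathcal{P}_\Delta$ is an $s$-dimensional crosspolytope if and only if $H_d(\Delta;\mathbb{Z})=0$.
   Context: For $j\ge1$ the boundary map $\partial_j$ of a simplicial complex on $[n]$ sends $\{i_1<\dots<i_{j+1}\}$ to $\sum_k(-1)^{k+1}(\sigma\setminus\{i_k\})$, identified with its integer matrix. $\mathcal{P}_\Delta=\operatorname{conv}$ of the columns of $\partial_d$ and $-\partial_d$ for $d=\dim\Delta$; $f_d(\Delta)$ is the number of $d$-faces. An $s$-dimensional crosspolytope is a polytope combinatorially equivalent to $\operatorname{conv}(\pm\mathbf{e}_1,\dots,\pm\mathbf{e}_s)$.
   Formalization: The polytopes $\mathcal{P}_\Delta$ and $\operatorname{conv}(\pm\mathbf{e}_1,\dots,\pm\mathbf{e}_s)$ consist of points with rational coordinates, and the supporting hyperplanes defining their faces have rational coefficients. -}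

module Defs where

open import Level using (Level)
open import Data.Nat as ℕ using (ℕ; zero; suc; _+_)
open import Data.Fin as Fin using (Fin; zero; suc; toℕ; splitAt)
open import Data.Sum using ([_,_]′)
open import Data.Product using (Σ; ∃; _×_; _,_)
open import Data.Bool using (if_then_else_)
open import Data.List using (List; length; filter; lookup; removeAt)
open import Data.List.Properties using (≡-dec)
open import Data.List.Relation.Unary.All using (All)
open import Data.List.Relation.Unary.Any using (Any)
open import Data.List.Relation.Unary.Linked using (Linked)
open import Data.List.Relation.Unary.Unique.Propositional using (Unique)
open import Data.List.Relation.Binary.Sublist.Propositional using (_⊆_)
open import Data.List.Membership.Propositional using (_∈_)
open import Data.Integer as ℤ using (ℤ)
open import Data.Rational as ℚ using (ℚ; 0ℚ; 1ℚ)
open import Relation.Binary.PropositionalEquality using (_≡_)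
open import Relation.Nullary using (does)

-- A face {i₁ < … < i_{j+1}} is stored as the strictly increasing list
-- i₁ ∷ … ∷ i_{j+1}.  We store the nonempty faces (the empty face plays no
-- role for the boundary maps ∂_j, j ≥ 1).

record SimplicialComplex (n : ℕ) : Set where
  field
    faces      : List (List (Fin n))
    increasing : All (Linked Fin._<_) faces
    nonempty   : All (λ σ → 1 ℕ.≤ length σ) faces
    unique     : Unique faces
    closed     : ∀ {σ τ} → σ ∈ faces → τ ⊆ σ → 1 ℕ.≤ length τ → τ ∈ faces

open SimplicialComplex public

HasDim : ∀ {n} → SimplicialComplex n → ℕ → Set
HasDim Δ d = All (λ σ → length σ ℕ.≤ suc d) (faces Δ)
           × Any (λ σ → length σ ≡ suc d) (faces Δ)

-- the j-dimensional faces (= faces with j+1 vertices), in the stored order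
kfaces : ∀ {n} → SimplicialComplex n → ℕ → List (List (Fin n))
kfaces Δ k = filter (λ σ → length σ ℕ.≟ k) (faces Δ)

fnum : ∀ {n} → SimplicialComplex n → ℕ → ℕ
fnum Δ j = length (kfaces Δ (suc j))

face : ∀ {n} (Δ : SimplicialComplex n) (j : ℕ) → Fin (fnum Δ j) → List (Fin n)
face Δ j i = lookup (kfaces Δ (suc j)) i

sgn : ℕ → ℤ
sgn zero    = ℤ.1ℤ
sgn (suc k) = ℤ.- sgn k

Σℤ : (k : ℕ) → (Fin k → ℤ) → ℤ
Σℤ zero    f = ℤ.0ℤ
Σℤ (suc k) f = f zero ℤ.+ Σℤ k (λ i → f (suc i))

Σℚ : (k : ℕ) → (Fin k → ℚ) → ℚ
Σℚ zero    f = 0ℚ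
Σℚ (suc k) f = f zero ℚ.+ Σℚ k (λ i → f (suc i))

-- coefficient of τ in ∂σ = Σ_k (-1)^{k+1} (σ \ {i_k})  (k 1-indexed;
-- with the 0-indexed position p = k-1 the sign is (-1)^p)
bdCoeff : ∀ {n} → List (Fin n) → List (Fin n) → ℤ
bdCoeff σ τ = Σℤ (length σ) (λ p →
  if does (≡-dec Fin._≟_ (removeAt σ p) τ) then sgn (toℕ p) else ℤ.0ℤ)

-- the integer matrix of ∂_j : C_j → C_{j-1}; rows = (j-1)-faces,
-- columns = j-faces.  (Here j ≥ 1 is intended; for j = 0 there are no rows.)
∂ : ∀ {n} (Δ : SimplicialComplex n) (j : ℕ) →
    Fin (length (kfaces Δ j)) → Fin (fnum Δ j) → ℤ
∂ Δ j r c = bdCoeff (face Δ j c) (lookup (kfaces Δ j) r)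

-- Homology: H_d(Δ;ℤ) = Z_d / B_d is zero iff every d-cycle is a d-boundary.

HdZero : ∀ {n} → SimplicialComplex n → ℕ → Set
HdZero Δ d =
  ∀ (z : Fin (fnum Δ d) → ℤ) →
    (∀ r → Σℤ (fnum Δ d) (λ c → ∂ Δ d r c ℤ.* z c) ≡ ℤ.0ℤ) →
    ∃ λ (w : Fin (fnum Δ (suc d)) → ℤ) →
      ∀ r → Σℤ (fnum Δ (suc d)) (λ c → ∂ Δ (suc d) r c ℤ.* w c) ≡ z r

Pt : ℕ → Set
Pt m = Fin m → ℚ

dot : ∀ {m} → Pt m → Pt m → ℚ
dot {m} c x = Σℚ m (λ r → c r ℚ.* x r)

InConv : ∀ {k m} → (Fin k → Pt m) → Pt m → Set
InConv {k} {m} V x =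
  ∃ λ (λ′ : Fin k → ℚ) → (∀ i → 0ℚ ℚ.≤ λ′ i) × Σℚ k λ′ ≡ 1ℚ
    × (∀ r → x r ≡ Σℚ k (λ i → λ′ i ℚ.* V i r))

-- F is a face of P = conv V: F = P ∩ {c·x = h} for a valid inequality c·x ≤ h
-- (this includes ∅ and P itself).
IsFace : ∀ {k m} → (Fin k → Pt m) → (Pt m → Set) → Set
IsFace {k} {m} V F =
  ∃ λ (c : Pt m) → ∃ λ (h : ℚ) →
    (∀ x → InConv V x → dot c x ℚ.≤ h) ×
    (∀ x → (F x → InConv V x × dot c x ≡ h) × (InConv V x × dot c x ≡ h → F x))

Face : ∀ {k m} → (Fin k → Pt m) → Set₁
Face {k} {m} V = Σ (Pt m → Set) (IsFace V)

_⊆F_ : ∀ {k m} {V : Fin k → Pt m} → Face V → Face V → Set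
(F , _) ⊆F (G , _) = ∀ x → F x → G x

_≈F_ : ∀ {k m} {V : Fin k → Pt m} → Face V → Face V → Set
F ≈F G = (F ⊆F G) × (G ⊆F F)

CombEquiv : ∀ {k m k′ m′} → (Fin k → Pt m) → (Fin k′ → Pt m′) → Set₁
CombEquiv V W =
  Σ (Face V → Face W) λ φ → Σ (Face W → Face V) λ ψ →
    (∀ F → ψ (φ F) ≈F F) × (∀ G → φ (ψ G) ≈F G) ×
    (∀ F F′ → (F ⊆F F′ → φ F ⊆F φ F′) × (φ F ⊆F φ F′ → F ⊆F F′))

±fam : ∀ {k m} → (Fin k → Pt m) → Fin (k + k) → Pt m
±fam {k} v i = [ v , (λ j r → ℚ.- v j r) ]′ (splitAt k i)

PΔverts : ∀ {n} (Δ : SimplicialComplex n) (d : ℕ) →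
          Fin (fnum Δ d + fnum Δ d) → Pt (length (kfaces Δ d))
PΔverts Δ d = ±fam (λ c r → ∂ Δ d r c ℚ./ 1)

crossVerts : (s : ℕ) → Fin (s + s) → Pt s
crossVerts s = ±fam (λ i r → if does (i Fin.≟ r) then 1ℚ else 0ℚ)

IsCrosspolytope : ∀ {k m} → ℕ → (Fin k → Pt m) → Set₁
IsCrosspolytope s V = CombEquiv V (crossVerts s)

-- Δ has no (d+1)-faces, so H_d(Δ;ℤ) = ker ∂_d, and the theorem says: for the columns
-- v_1, …, v_s of ∂_d, conv(±v) is an s-crosspolytope iff the v_k are linearly independent
-- (over ℤ, equivalently over ℚ after clearing denominators).
--
-- If they are independent, Gaussian elimination yields a dual basis. Then linear functionals
-- on both sides correspond so that values on ±v_k and on ±e_k agree, and carrying supporting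
-- inequalities across gives the isomorphism of face lattices.
--
-- Conversely, a lattice isomorphism ψ assigns to each vertex ±e of the crosspolytope a
-- generator lying in the image of that vertex. This assignment is injective, hence bijective.
-- It commutes with x ↦ −x: otherwise the image of a facet through two non-antipodal vertices
-- would contain some x and −x, but a face of a symmetric polytope containing both has level 0
-- and is everything. So for every sign pattern t, the image of a suitable facet is a proper
-- face containing all t_k v_k. If Σ a_k v_k = 0 with a ≠ 0, take t = sign a:
-- that face contains 0, the barycentre of the t_k v_k with weights ∣a_k∣, which forces level 0.

module Submission where

open import Defs
open import Data.Nat using (ℕ; zero; suc; _≤_)
open import Function.Bundles using (_⇔_)

open import Data.Bool using (Bool; true; false; not; if_then_else_)
open import Data.Bool.Properties using (not-¬)
import Data.Bool as Bool
open import Data.Empty using (⊥-elim)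
open import Data.Fin using (Fin; zero; suc; _↑ˡ_; _↑ʳ_; splitAt; punchOut)
import Data.Fin as Fin
open import Data.Fin.Properties
  using (any?; splitAt-↑ˡ; splitAt-↑ʳ; join-splitAt; punchOut-injective; injective⇒≤)
import Data.Integer as ℤ
open import Data.Integer using (ℤ; 0ℤ)
import Data.Integer.Properties as ℤP
open import Data.List using (length)
open import Data.List.Properties using (filter-none)
import Data.List.Relation.Unary.All as All
import Data.Nat as ℕ
import Data.Nat.Coprimality as Coprimality
import Data.Nat.Properties as ℕP
open import Data.Product using (∃; _×_; _,_; proj₁; proj₂)
open import Data.Rational using (ℚ; 0ℚ; 1ℚ; _+_; _*_; -_; 1/_) renaming (_≤_ to _≤ℚ_)
import Data.Rational as ℚ
import Data.Rational.Properties as ℚP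
import Data.Rational.Unnormalised as ℚᵘ
open import Data.Rational.Solver using (module +-*-Solver)
open +-*-Solver
open import Data.Sum using (_⊎_; inj₁; inj₂; [_,_]′)
import Data.Sum as Sum
open import Function using (_∘_)
open import Function.Bundles using (mk⇔; Equivalence)
open import Function.Definitions using (Injective)
open import Relation.Binary.PropositionalEquality
open import Relation.Nullary using (¬_; Dec; yes; no; does; contradiction; ¬?)
open import Relation.Nullary.Decidable using (True; toWitness; dec-true; dec-false; decidable-stable)
open import Algebra.Properties.Group ℚP.+-0-group using (⁻¹-involutive; x∙y⁻¹≈ε⇒x≈y)

decide-≤ : ∀ {p q} {holds : True (p ℚP.≤? q)} → p ≤ℚ q
decide-≤ {holds = holds} = toWitness holds

≤∧≢⇒< : ∀ {p q} → p ≤ℚ q → p ≢ q → p ℚ.< q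
≤∧≢⇒< {p} {q} p≤q p≢q with q ℚP.≤? p
... | yes q≤p = contradiction (ℚP.≤-antisym p≤q q≤p) p≢q
... | no  q≰p = ℚP.≰⇒> q≰p

+-≤-≡⇒≡ˡ : ∀ {a b h₁ h₂} → a ≤ℚ h₁ → b ≤ℚ h₂ → a + b ≡ h₁ + h₂ → a ≡ h₁
+-≤-≡⇒≡ˡ {a} {h₁ = h₁} a≤h₁ b≤h₂ sum≡ with a ℚP.≟ h₁
... | yes a≡h₁ = a≡h₁
... | no  a≢h₁ = contradiction sum≡ (ℚP.<⇒≢ (ℚP.+-mono-<-≤ (≤∧≢⇒< a≤h₁ a≢h₁) b≤h₂))

p*q≡0⇒p≡0 : ∀ {p q} → p * q ≡ 0ℚ → q ≢ 0ℚ → p ≡ 0ℚ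
p*q≡0⇒p≡0 {p} {q} pq≡0 q≢0 = begin
  p                ≡⟨ sym (ℚP.*-identityʳ p) ⟩
  p * 1ℚ           ≡⟨ cong (p *_) (sym (ℚP.*-inverseʳ q)) ⟩
  p * (q * 1/ q)   ≡⟨ sym (ℚP.*-assoc p q (1/ q)) ⟩
  p * q * 1/ q     ≡⟨ cong (_* 1/ q) pq≡0 ⟩
  0ℚ * 1/ q        ≡⟨ ℚP.*-zeroˡ (1/ q) ⟩
  0ℚ               ∎
  where open ≡-Reasoning
        instance _ = ℚ.≢-nonZero q≢0

p≡-p⇒p≡0 : ∀ {p} → p ≡ - p → p ≡ 0ℚ
p≡-p⇒p≡0 {p} p≡-p with ℚP.≤-total 0ℚ p
... | inj₁ 0≤p = ℚP.≤-antisym (subst (_≤ℚ 0ℚ) (sym p≡-p) (ℚP.neg-antimono-≤ 0≤p)) 0≤p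
... | inj₂ p≤0 = ℚP.≤-antisym p≤0 (subst (0ℚ ≤ℚ_) (sym p≡-p) (ℚP.neg-antimono-≤ p≤0))

Σℚ-cong : ∀ k {f g : Fin k → ℚ} → (∀ i → f i ≡ g i) → Σℚ k f ≡ Σℚ k g
Σℚ-cong zero    f≡g = refl
Σℚ-cong (suc k) f≡g = cong₂ _+_ (f≡g zero) (Σℚ-cong k (f≡g ∘ suc))

Σℚ-zero : ∀ k → Σℚ k (λ _ → 0ℚ) ≡ 0ℚ
Σℚ-zero zero    = refl
Σℚ-zero (suc k) = cong (0ℚ +_) (Σℚ-zero k)

Σℚ-+ : ∀ k (f g : Fin k → ℚ) → Σℚ k (λ i → f i + g i) ≡ Σℚ k f + Σℚ k g
Σℚ-+ zero    f g = refl
Σℚ-+ (suc k) f g = trans (cong (f zero + g zero +_) (Σℚ-+ k (f ∘ suc) (g ∘ suc)))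
  (solve 4 (λ a b c d → (a :+ b) :+ (c :+ d) := (a :+ c) :+ (b :+ d)) refl
     (f zero) (g zero) (Σℚ k (f ∘ suc)) (Σℚ k (g ∘ suc)))

Σℚ-*ˡ : ∀ k a (f : Fin k → ℚ) → Σℚ k (λ i → a * f i) ≡ a * Σℚ k f
Σℚ-*ˡ zero    a f = sym (ℚP.*-zeroʳ a)
Σℚ-*ˡ (suc k) a f = trans (cong (a * f zero +_) (Σℚ-*ˡ k a (f ∘ suc)))
  (sym (ℚP.*-distribˡ-+ a (f zero) (Σℚ k (f ∘ suc))))

Σℚ-*ʳ : ∀ k a (f : Fin k → ℚ) → Σℚ k (λ i → f i * a) ≡ Σℚ k f * a
Σℚ-*ʳ k a f = trans (Σℚ-cong k (λ i → ℚP.*-comm (f i) a))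
  (trans (Σℚ-*ˡ k a f) (ℚP.*-comm a (Σℚ k f)))

Σℚ-neg : ∀ k (f : Fin k → ℚ) → Σℚ k (λ i → - f i) ≡ - Σℚ k f
Σℚ-neg zero    f = refl
Σℚ-neg (suc k) f = trans (cong (- f zero +_) (Σℚ-neg k (f ∘ suc)))
  (sym (ℚP.neg-distrib-+ (f zero) (Σℚ k (f ∘ suc))))

Σℚ-swap : ∀ k l (f : Fin k → Fin l → ℚ) →
          Σℚ k (λ i → Σℚ l (f i)) ≡ Σℚ l (λ j → Σℚ k (λ i → f i j))
Σℚ-swap zero    l f = sym (Σℚ-zero l)
Σℚ-swap (suc k) l f = trans (cong (Σℚ l (f zero) +_) (Σℚ-swap k l (f ∘ suc)))
  (sym (Σℚ-+ l (f zero) _))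

Σℚ-mono-≤ : ∀ k {f g : Fin k → ℚ} → (∀ i → f i ≤ℚ g i) → Σℚ k f ≤ℚ Σℚ k g
Σℚ-mono-≤ zero    f≤g = ℚP.≤-refl
Σℚ-mono-≤ (suc k) f≤g = ℚP.+-mono-≤ (f≤g zero) (Σℚ-mono-≤ k (f≤g ∘ suc))

Σℚ-nonNeg : ∀ k {f : Fin k → ℚ} → (∀ i → 0ℚ ≤ℚ f i) → 0ℚ ≤ℚ Σℚ k f
Σℚ-nonNeg k {f} 0≤f = subst (_≤ℚ Σℚ k f) (Σℚ-zero k) (Σℚ-mono-≤ k 0≤f)

term≤Σℚ : ∀ k {f : Fin k → ℚ} → (∀ i → 0ℚ ≤ℚ f i) → ∀ i → f i ≤ℚ Σℚ k f
term≤Σℚ (suc k) {f} 0≤f zero = subst (_≤ℚ Σℚ (suc k) f) (ℚP.+-identityʳ (f zero))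
  (ℚP.+-mono-≤ (ℚP.≤-refl {f zero}) (Σℚ-nonNeg k (0≤f ∘ suc)))
term≤Σℚ (suc k) {f} 0≤f (suc i) = subst (_≤ℚ Σℚ (suc k) f) (ℚP.+-identityˡ (f (suc i)))
  (ℚP.+-mono-≤ (0≤f zero) (term≤Σℚ k (0≤f ∘ suc) i))

Σℚ-nonNeg≡0⇒≡0 : ∀ k {f : Fin k → ℚ} → (∀ i → 0ℚ ≤ℚ f i) → Σℚ k f ≡ 0ℚ → ∀ i → f i ≡ 0ℚ
Σℚ-nonNeg≡0⇒≡0 k {f} 0≤f Σ≡0 i =
  ℚP.≤-antisym (subst (f i ≤ℚ_) Σ≡0 (term≤Σℚ k 0≤f i)) (0≤f i)

δ : ∀ {k} → Fin k → Fin k → ℚ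
δ i j = if does (i Fin.≟ j) then 1ℚ else 0ℚ

δ-refl : ∀ {k} (i : Fin k) → δ i i ≡ 1ℚ
δ-refl i with i Fin.≟ i
... | yes _   = refl
... | no  i≢i = contradiction refl i≢i

δ-≢ : ∀ {k} {i j : Fin k} → i ≢ j → δ i j ≡ 0ℚ
δ-≢ {i = i} {j} i≢j with i Fin.≟ j
... | yes i≡j = contradiction i≡j i≢j
... | no  _   = refl

δ-sym : ∀ {k} (i j : Fin k) → δ i j ≡ δ j i
δ-sym i j with i Fin.≟ j
... | yes refl = sym (δ-refl i)
... | no  i≢j  = sym (δ-≢ (i≢j ∘ sym))

δ-nonNeg : ∀ {k} (i j : Fin k) → 0ℚ ≤ℚ δ i j
δ-nonNeg i j with does (i Fin.≟ j)
... | true  = decide-≤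
... | false = ℚP.≤-refl

Σℚ-δˡ : ∀ k (i : Fin k) (f : Fin k → ℚ) → Σℚ k (λ j → δ i j * f j) ≡ f i
Σℚ-δˡ (suc k) zero f = begin
  1ℚ * f zero + Σℚ k (λ j → 0ℚ * f (suc j)) ≡⟨ cong₂ _+_ (ℚP.*-identityˡ (f zero))
                                                 (Σℚ-cong k (λ j → ℚP.*-zeroˡ (f (suc j)))) ⟩
  f zero + Σℚ k (λ _ → 0ℚ)                   ≡⟨ cong (f zero +_) (Σℚ-zero k) ⟩
  f zero + 0ℚ                                ≡⟨ ℚP.+-identityʳ (f zero) ⟩
  f zero                                     ∎
  where open ≡-Reasoning
Σℚ-δˡ (suc k) (suc i) f = trans (cong₂ _+_ (ℚP.*-zeroˡ (f zero)) (Σℚ-δˡ k i (f ∘ suc)))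
  (ℚP.+-identityˡ (f (suc i)))

Σℚ-δʳ : ∀ k (i : Fin k) (f : Fin k → ℚ) → Σℚ k (λ j → f j * δ i j) ≡ f i
Σℚ-δʳ k i f = trans (Σℚ-cong k (λ j → ℚP.*-comm (f j) (δ i j))) (Σℚ-δˡ k i f)

Σℚ-δ : ∀ k (i : Fin k) → Σℚ k (δ i) ≡ 1ℚ
Σℚ-δ k i = trans (Σℚ-cong k (λ j → sym (ℚP.*-identityʳ (δ i j)))) (Σℚ-δˡ k i (λ _ → 1ℚ))

lincomb : ∀ {k m} → (Fin k → ℚ) → (Fin k → Pt m) → Pt m
lincomb {k} a v r = Σℚ k (λ i → a i * v i r)

dot-congʳ : ∀ {m} (c : Pt m) {x x′ : Pt m} → (∀ r → x r ≡ x′ r) → dot c x ≡ dot c x′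
dot-congʳ {m} c x≡x′ = Σℚ-cong m (λ r → cong (c r *_) (x≡x′ r))

dot-comm : ∀ {m} (c x : Pt m) → dot c x ≡ dot x c
dot-comm {m} c x = Σℚ-cong m (λ r → ℚP.*-comm (c r) (x r))

dot-lincombʳ : ∀ {k m} (c : Pt m) (a : Fin k → ℚ) (v : Fin k → Pt m) →
               dot c (lincomb a v) ≡ Σℚ k (λ i → a i * dot c (v i))
dot-lincombʳ {k} {m} c a v = begin
  Σℚ m (λ r → c r * Σℚ k (λ i → a i * v i r))   ≡⟨ Σℚ-cong m (λ r → sym (Σℚ-*ˡ k (c r) _)) ⟩
  Σℚ m (λ r → Σℚ k (λ i → c r * (a i * v i r))) ≡⟨ Σℚ-swap m k _ ⟩
  Σℚ k (λ i → Σℚ m (λ r → c r * (a i * v i r))) ≡⟨ Σℚ-cong k (λ i → trans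
                                                      (Σℚ-cong m (λ r → swap-* (c r) (a i) (v i r)))
                                                      (Σℚ-*ˡ m (a i) _)) ⟩
  Σℚ k (λ i → a i * dot c (v i))                ∎
  where open ≡-Reasoning
        swap-* : ∀ x y z → x * (y * z) ≡ y * (x * z)
        swap-* = solve 3 (λ x y z → x :* (y :* z) := y :* (x :* z)) refl

dot-lincombˡ : ∀ {k m} (a : Fin k → ℚ) (v : Fin k → Pt m) (x : Pt m) →
               dot (lincomb a v) x ≡ Σℚ k (λ i → a i * dot (v i) x)
dot-lincombˡ {k} a v x = trans (dot-comm (lincomb a v) x)
  (trans (dot-lincombʳ x a v) (Σℚ-cong k (λ i → cong (a i *_) (dot-comm x (v i)))))

dot-+ˡ : ∀ {m} (c c′ x : Pt m) → dot (λ r → c r + c′ r) x ≡ dot c x + dot c′ x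
dot-+ˡ {m} c c′ x = trans (Σℚ-cong m (λ r → ℚP.*-distribʳ-+ (x r) (c r) (c′ r))) (Σℚ-+ m _ _)

dot-+ʳ : ∀ {m} (c x x′ : Pt m) → dot c (λ r → x r + x′ r) ≡ dot c x + dot c x′
dot-+ʳ {m} c x x′ = trans (Σℚ-cong m (λ r → ℚP.*-distribˡ-+ (c r) (x r) (x′ r))) (Σℚ-+ m _ _)

dot-*ˡ : ∀ {m} a (c x : Pt m) → dot (λ r → a * c r) x ≡ a * dot c x
dot-*ˡ {m} a c x = trans (Σℚ-cong m (λ r → ℚP.*-assoc a (c r) (x r))) (Σℚ-*ˡ m a _)

dot-*ʳ : ∀ {m} a (c x : Pt m) → dot c (λ r → a * x r) ≡ a * dot c x
dot-*ʳ a c x = trans (dot-comm c (λ r → a * x r)) (trans (dot-*ˡ a x c) (cong (a *_) (dot-comm x c)))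

dot-negˡ : ∀ {m} (c x : Pt m) → dot (λ r → - c r) x ≡ - dot c x
dot-negˡ {m} c x = trans (Σℚ-cong m (λ r → sym (ℚP.neg-distribˡ-* (c r) (x r)))) (Σℚ-neg m _)

dot-negʳ : ∀ {m} (c x : Pt m) → dot c (λ r → - x r) ≡ - dot c x
dot-negʳ {m} c x = trans (Σℚ-cong m (λ r → sym (ℚP.neg-distribʳ-* (c r) (x r)))) (Σℚ-neg m _)

dot-zeroˡ : ∀ {m} (x : Pt m) → dot (λ _ → 0ℚ) x ≡ 0ℚ
dot-zeroˡ {m} x = trans (Σℚ-cong m (λ r → ℚP.*-zeroˡ (x r))) (Σℚ-zero m)

dot-zeroʳ : ∀ {m} (c : Pt m) → dot c (λ _ → 0ℚ) ≡ 0ℚ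
dot-zeroʳ {m} c = trans (Σℚ-cong m (λ r → ℚP.*-zeroʳ (c r))) (Σℚ-zero m)

dot-minus-scaledˡ : ∀ {m} a (c c′ x : Pt m) → dot (λ r → c r + - (a * c′ r)) x ≡ dot c x + - (a * dot c′ x)
dot-minus-scaledˡ a c c′ x = trans (dot-+ˡ c _ x)
  (cong (dot c x +_) (trans (dot-negˡ (λ r → a * c′ r) x) (cong -_ (dot-*ˡ a c′ x))))

dot-minus-scaledʳ : ∀ {m} a (c x x′ : Pt m) → dot c (λ r → x r + - (a * x′ r)) ≡ dot c x + - (a * dot c x′)
dot-minus-scaledʳ a c x x′ = trans (dot-+ʳ c x _)
  (cong (dot c x +_) (trans (dot-negʳ c (λ r → a * x′ r)) (cong -_ (dot-*ʳ a c x′))))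

dot-δʳ : ∀ {m} (c : Pt m) (r : Fin m) → dot c (δ r) ≡ c r
dot-δʳ {m} c r = Σℚ-δʳ m r c

generator∈conv : ∀ {K m} (V : Fin K → Pt m) i → InConv V (V i)
generator∈conv {K} V i = δ i , δ-nonNeg i , Σℚ-δ K i , (λ r → sym (Σℚ-δˡ K i (λ j → V j r)))

Σℚ-weighted-const : ∀ K {l : Fin K → ℚ} → Σℚ K l ≡ 1ℚ → ∀ h → Σℚ K (λ i → l i * h) ≡ h
Σℚ-weighted-const K {l} Σl≡1 h =
  trans (Σℚ-*ʳ K h l) (trans (cong (_* h) Σl≡1) (ℚP.*-identityˡ h))

dot-conv : ∀ {K m} {V : Fin K → Pt m} {x} (c : Pt m) (x∈ : InConv V x) →
           dot c x ≡ Σℚ K (λ i → proj₁ x∈ i * dot c (V i))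
dot-conv {V = V} c (l , _ , _ , x≡) = trans (dot-congʳ c x≡) (dot-lincombʳ c l V)

conv-≤ : ∀ {K m} {V : Fin K → Pt m} (c : Pt m) h → (∀ i → dot c (V i) ≤ℚ h) →
         ∀ x → InConv V x → dot c x ≤ℚ h
conv-≤ {K} {V = V} c h V≤h x x∈@(l , 0≤l , Σl≡1 , _) = begin
  dot c x                        ≡⟨ dot-conv c x∈ ⟩
  Σℚ K (λ i → l i * dot c (V i)) ≤⟨ Σℚ-mono-≤ K (λ i →
                                      ℚP.*-monoˡ-≤-nonNeg (l i) {{ℚ.nonNegative (0≤l i)}} (V≤h i)) ⟩
  Σℚ K (λ i → l i * h)           ≡⟨ Σℚ-weighted-const K Σl≡1 h ⟩
  h                              ∎
  where open ℚP.≤-Reasoning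

conv-agree : ∀ {K m} {V : Fin K → Pt m} (c c′ : Pt m) → (∀ i → dot c (V i) ≡ dot c′ (V i)) →
             ∀ x → InConv V x → dot c x ≡ dot c′ x
conv-agree {K} c c′ agree x x∈ = trans (dot-conv c x∈)
  (trans (Σℚ-cong K (λ i → cong (proj₁ x∈ i *_) (agree i))) (sym (dot-conv c′ x∈)))

reweight : ∀ {K m m′} {V : Fin K → Pt m} (W : Fin K → Pt m′) {x} → InConv V x → Pt m′
reweight W (l , _) = lincomb l W

reweight-conv : ∀ {K m m′} {V : Fin K → Pt m} (W : Fin K → Pt m′) {x} (x∈ : InConv V x) →
                InConv W (reweight W x∈)
reweight-conv W (l , 0≤l , Σl≡1 , _) = l , 0≤l , Σl≡1 , (λ _ → refl)

dot-reweight : ∀ {K m m′} {V : Fin K → Pt m} (W : Fin K → Pt m′) (c : Pt m) (c′ : Pt m′) →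
               (∀ i → dot c (V i) ≡ dot c′ (W i)) →
               ∀ {x} (x∈ : InConv V x) → dot c x ≡ dot c′ (reweight W x∈)
dot-reweight {K} W c c′ agree x∈ = trans (dot-conv c x∈)
  (trans (Σℚ-cong K (λ i → cong (proj₁ x∈ i *_) (agree i))) (sym (dot-lincombʳ c′ (proj₁ x∈) W)))

-- The slacks l i (h − c·V i) are nonnegative and add up to h − c·x = 0.
off-hyperplane-weight≡0 : ∀ {K m} {V : Fin K → Pt m} (c : Pt m) (h : ℚ) → (∀ i → dot c (V i) ≤ℚ h) →
                          ∀ {x} (x∈ : InConv V x) → dot c x ≡ h →
                          ∀ i → dot c (V i) ≢ h → proj₁ x∈ i ≡ 0ℚ
off-hyperplane-weight≡0 {K} {V = V} c h V≤h {x} x∈@(l , 0≤l , Σl≡1 , _) cx≡h i off =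
  p*q≡0⇒p≡0 (Σℚ-nonNeg≡0⇒≡0 K 0≤slack Σslack≡0 i) (off ∘ sym ∘ x∙y⁻¹≈ε⇒x≈y h (dot c (V i)))
  where
  slack : Fin K → ℚ
  slack i = l i * (h + - dot c (V i))
  0≤slack : ∀ i → 0ℚ ≤ℚ slack i
  0≤slack i = ℚP.nonNegative⁻¹ _ {{ℚP.nonNeg*nonNeg⇒nonNeg (l i) {{ℚ.nonNegative (0≤l i)}} _
    {{ℚ.nonNegative (subst (_≤ℚ h + - dot c (V i)) (ℚP.+-inverseʳ (dot c (V i)))
                      (ℚP.+-monoˡ-≤ (- dot c (V i)) (V≤h i)))}}}}
  Σslack≡0 : Σℚ K slack ≡ 0ℚ
  Σslack≡0 = begin
    Σℚ K slack
      ≡⟨ Σℚ-cong K (λ i → ℚP.*-distribˡ-+ (l i) h (- dot c (V i))) ⟩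
    Σℚ K (λ i → l i * h + l i * - dot c (V i))
      ≡⟨ Σℚ-+ K _ _ ⟩
    Σℚ K (λ i → l i * h) + Σℚ K (λ i → l i * - dot c (V i))
      ≡⟨ cong₂ _+_ (Σℚ-weighted-const K Σl≡1 h) (Σℚ-cong K (λ i → sym (ℚP.neg-distribʳ-* (l i) _))) ⟩
    h + Σℚ K (λ i → - (l i * dot c (V i)))
      ≡⟨ cong (h +_) (Σℚ-neg K _) ⟩
    h + - Σℚ K (λ i → l i * dot c (V i))
      ≡⟨ cong (λ y → h + - y) (trans (sym (dot-conv c x∈)) cx≡h) ⟩
    h + - h
      ≡⟨ ℚP.+-inverseʳ h ⟩
    0ℚ ∎
    where open ≡-Reasoning

module _ {K m} {V : Fin K → Pt m} where

  _∈F_ : Pt m → Face V → Set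
  x ∈F F = proj₁ F x

  normal : Face V → Pt m
  normal F = proj₁ (proj₂ F)

  level : Face V → ℚ
  level F = proj₁ (proj₂ (proj₂ F))

  normal-≤ : (F : Face V) → ∀ x → InConv V x → dot (normal F) x ≤ℚ level F
  normal-≤ F = proj₁ (proj₂ (proj₂ (proj₂ F)))

  generator-≤ : (F : Face V) → ∀ i → dot (normal F) (V i) ≤ℚ level F
  generator-≤ F i = normal-≤ F (V i) (generator∈conv V i)

  ∈F-conv : (F : Face V) → ∀ {x} → x ∈F F → InConv V x
  ∈F-conv F {x} x∈F = proj₁ (proj₁ (proj₂ (proj₂ (proj₂ (proj₂ F))) x) x∈F)

  ∈F-level : (F : Face V) → ∀ {x} → x ∈F F → dot (normal F) x ≡ level F
  ∈F-level F {x} x∈F = proj₂ (proj₁ (proj₂ (proj₂ (proj₂ (proj₂ F))) x) x∈F)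

  ∈F-intro : (F : Face V) → ∀ {x} → InConv V x → dot (normal F) x ≡ level F → x ∈F F
  ∈F-intro F {x} x∈ on = proj₂ (proj₂ (proj₂ (proj₂ (proj₂ F))) x) (x∈ , on)

  Improper : Face V → Set
  Improper F = ∀ x → InConv V x → x ∈F F

  Empty : Face V → Set
  Empty F = ∀ x → ¬ x ∈F F

faceOf : ∀ {K m} (V : Fin K → Pt m) (c : Pt m) (h : ℚ) → (∀ i → dot c (V i) ≤ℚ h) → Face V
faceOf V c h V≤h = (λ x → InConv V x × dot c x ≡ h) , c , h , conv-≤ c h V≤h , (λ _ → (λ p → p) , (λ p → p))

emptyFace : ∀ {K m} (V : Fin K → Pt m) → Face V
emptyFace V = faceOf V (λ _ → 0ℚ) 1ℚ (λ i → subst (_≤ℚ 1ℚ) (sym (dot-zeroˡ (V i))) decide-≤)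

emptyFace-empty : ∀ {K m} (V : Fin K → Pt m) → Empty (emptyFace V)
emptyFace-empty V x (_ , 0≡1) = contradiction (trans (sym (dot-zeroˡ x)) 0≡1) λ ()

fullFace : ∀ {K m} (V : Fin K → Pt m) → Face V
fullFace V = faceOf V (λ _ → 0ℚ) 0ℚ (λ i → ℚP.≤-reflexive (dot-zeroˡ (V i)))

fullFace-improper : ∀ {K m} (V : Fin K → Pt m) → Improper (fullFace V)
fullFace-improper V x x∈ = x∈ , dot-zeroˡ x

module _ {K m} {V : Fin K → Pt m} where

  _∩F_ : Face V → Face V → Face V
  F ∩F G = faceOf V (λ r → normal F r + normal G r) (level F + level G) (λ i →
    subst (_≤ℚ level F + level G) (sym (dot-+ˡ (normal F) (normal G) (V i)))
      (ℚP.+-mono-≤ (generator-≤ F i) (generator-≤ G i)))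

  ∈∩F : (F G : Face V) → ∀ {x} → x ∈F F → x ∈F G → x ∈F (F ∩F G)
  ∈∩F F G x∈F x∈G = ∈F-conv F x∈F ,
    trans (dot-+ˡ (normal F) (normal G) _) (cong₂ _+_ (∈F-level F x∈F) (∈F-level G x∈G))

  ∩F-⊆ˡ : (F G : Face V) → (F ∩F G) ⊆F F
  ∩F-⊆ˡ F G x (x∈ , on) = ∈F-intro F x∈ (+-≤-≡⇒≡ˡ (normal-≤ F x x∈) (normal-≤ G x x∈)
    (trans (sym (dot-+ˡ (normal F) (normal G) x)) on))

  ∩F-⊆ʳ : (F G : Face V) → (F ∩F G) ⊆F G
  ∩F-⊆ʳ F G x (x∈ , on) = ∈F-intro G x∈ (+-≤-≡⇒≡ˡ (normal-≤ G x x∈) (normal-≤ F x x∈)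
    (trans (ℚP.+-comm (dot (normal G) x) (dot (normal F) x))
      (trans (sym (dot-+ˡ (normal F) (normal G) x)) (trans on (ℚP.+-comm (level F) (level G))))))

  generator-or-empty : (F : Face V) → (∃ λ i → V i ∈F F) ⊎ Empty F
  generator-or-empty F with any? (λ i → dot (normal F) (V i) ℚP.≟ level F)
  ... | yes (i , on) = inj₁ (i , ∈F-intro F (generator∈conv V i) on)
  ... | no  none     = inj₂ λ x x∈F →
    let x∈@(l , _ , Σl≡1 , _) = ∈F-conv F x∈F
        l≡0 i = off-hyperplane-weight≡0 (normal F) (level F) (generator-≤ F) x∈ (∈F-level F x∈F) i
                  (λ on → none (i , on))
    in contradiction (trans (sym Σl≡1) (trans (Σℚ-cong K l≡0) (Σℚ-zero K))) λ ()

  ⊆F-by-generators : (F G : Face V) → (∀ i → V i ∈F F → V i ∈F G) → F ⊆F G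
  ⊆F-by-generators F G F⊆G x x∈F = ∈F-intro G x∈ (begin
    dot (normal G) x                        ≡⟨ dot-conv (normal G) x∈ ⟩
    Σℚ K (λ i → l i * dot (normal G) (V i)) ≡⟨ Σℚ-cong K term ⟩
    Σℚ K (λ i → l i * level G)              ≡⟨ Σℚ-weighted-const K Σl≡1 (level G) ⟩
    level G                                 ∎)
    where
    open ≡-Reasoning
    x∈ = ∈F-conv F x∈F
    l = proj₁ x∈
    Σl≡1 = proj₁ (proj₂ (proj₂ x∈))
    term : ∀ i → l i * dot (normal G) (V i) ≡ l i * level G
    term i with dot (normal F) (V i) ℚP.≟ level F
    ... | yes on  = cong (l i *_) (∈F-level G (F⊆G i (∈F-intro F (generator∈conv V i) on)))
    ... | no  off = subst (λ w → w * dot (normal G) (V i) ≡ w * level G) (sym l≡0)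
                      (trans (ℚP.*-zeroˡ (dot (normal G) (V i))) (sym (ℚP.*-zeroˡ (level G))))
      where l≡0 = off-hyperplane-weight≡0 (normal F) (level F) (generator-≤ F) x∈ (∈F-level F x∈F) i off

module _ {k m k′ m′} {V : Fin k → Pt m} {W : Fin k′ → Pt m′} (iso : CombEquiv V W) where

  φ : Face V → Face W
  φ = proj₁ iso

  ψ : Face W → Face V
  ψ = proj₁ (proj₂ iso)

  ψ∘φ≈id : ∀ F → ψ (φ F) ≈F F
  ψ∘φ≈id = proj₁ (proj₂ (proj₂ iso))

  φ∘ψ≈id : ∀ G → φ (ψ G) ≈F G
  φ∘ψ≈id = proj₁ (proj₂ (proj₂ (proj₂ iso)))

  φ-mono : ∀ F F′ → F ⊆F F′ → φ F ⊆F φ F′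
  φ-mono F F′ = proj₁ (proj₂ (proj₂ (proj₂ (proj₂ iso))) F F′)

  φ-reflect : ∀ F F′ → φ F ⊆F φ F′ → F ⊆F F′
  φ-reflect F F′ = proj₂ (proj₂ (proj₂ (proj₂ (proj₂ iso))) F F′)

  ψ-mono : ∀ G G′ → G ⊆F G′ → ψ G ⊆F ψ G′
  ψ-mono G G′ G⊆G′ = φ-reflect (ψ G) (ψ G′) λ y y∈ →
    proj₂ (φ∘ψ≈id G′) y (G⊆G′ y (proj₁ (φ∘ψ≈id G) y y∈))

  ψ-reflect : ∀ G G′ → ψ G ⊆F ψ G′ → G ⊆F G′
  ψ-reflect G G′ ψG⊆ψG′ y y∈ =
    proj₁ (φ∘ψ≈id G′) y (φ-mono (ψ G) (ψ G′) ψG⊆ψG′ y (proj₂ (φ∘ψ≈id G) y y∈))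

combEquiv-sym : ∀ {k m k′ m′} {V : Fin k → Pt m} {W : Fin k′ → Pt m′} →
                CombEquiv V W → CombEquiv W V
combEquiv-sym iso = ψ iso , φ iso , φ∘ψ≈id iso , ψ∘φ≈id iso ,
  λ G G′ → ψ-mono iso G G′ , ψ-reflect iso G G′

module _ {k m k′ m′} {V : Fin k → Pt m} {W : Fin k′ → Pt m′} (iso : CombEquiv V W) where

  φ-empty : ∀ F → Empty F → Empty (φ iso F)
  φ-empty F F-empty y y∈φF = emptyFace-empty W y (proj₁ (φ∘ψ≈id iso (emptyFace W)) y
    (φ-mono iso F (ψ iso (emptyFace W)) (λ x x∈F → ⊥-elim (F-empty x x∈F)) y y∈φF))

  ψ-improper : ∀ G → Improper (ψ iso G) → Improper G
  ψ-improper G ψG-improper y y∈ = φfullV⊆G y (φ-mono iso (ψ iso (fullFace W)) (fullFace V) ψfullW⊆fullV y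
    (proj₂ (φ∘ψ≈id iso (fullFace W)) y (fullFace-improper W y y∈)))
    where
    φfullV⊆G : φ iso (fullFace V) ⊆F G
    φfullV⊆G x x∈ = proj₁ (φ∘ψ≈id iso G) x
      (φ-mono iso (fullFace V) (ψ iso G) (λ x′ x′∈ → ψG-improper x′ (proj₁ x′∈)) x x∈)
    ψfullW⊆fullV : ψ iso (fullFace W) ⊆F fullFace V
    ψfullW⊆fullV x x∈ = fullFace-improper V x (∈F-conv (ψ iso (fullFace W)) x∈)

ψ-empty : ∀ {k m k′ m′} {V : Fin k → Pt m} {W : Fin k′ → Pt m′} (iso : CombEquiv V W) →
          ∀ G → Empty G → Empty (ψ iso G)
ψ-empty iso = φ-empty (combEquiv-sym iso)

φ-generator : ∀ {k m k′ m′} {V : Fin k → Pt m} {W : Fin k′ → Pt m′} (iso : CombEquiv V W) →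
              ∀ F {x} → x ∈F F → ∃ λ γ → W γ ∈F φ iso F
φ-generator iso F {x} x∈F with generator-or-empty (φ iso F)
... | inj₁ found     = found
... | inj₂ φF-empty = ⊥-elim (ψ-empty iso (φ iso F) φF-empty x (proj₂ (ψ∘φ≈id iso F) x x∈F))

ψ-generator : ∀ {k m k′ m′} {V : Fin k → Pt m} {W : Fin k′ → Pt m′} (iso : CombEquiv V W) →
              ∀ G {y} → y ∈F G → ∃ λ i → V i ∈F ψ iso G
ψ-generator iso = φ-generator (combEquiv-sym iso)

module _ {K m} {V : Fin K → Pt m} where

  ≈F-by-normals : (F G : Face V) → level F ≡ level G →
                  (∀ i → dot (normal F) (V i) ≡ dot (normal G) (V i)) → F ≈F G
  ≈F-by-normals F G hF≡hG agree = F⊆G , G⊆F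
    where
    F⊆G : F ⊆F G
    F⊆G x x∈F = ∈F-intro G x∈
      (trans (sym (conv-agree (normal F) (normal G) agree x x∈)) (trans (∈F-level F x∈F) hF≡hG))
      where x∈ = ∈F-conv F x∈F
    G⊆F : G ⊆F F
    G⊆F x x∈G = ∈F-intro F x∈
      (trans (conv-agree (normal F) (normal G) agree x x∈) (trans (∈F-level G x∈G) (sym hF≡hG)))
      where x∈ = ∈F-conv G x∈G

-- Faces are transported by carrying their defining inequality along f and g.
combEquiv-by-functionals : ∀ {K m m′} (V : Fin K → Pt m) (W : Fin K → Pt m′)
  (f : Pt m → Pt m′) (g : Pt m′ → Pt m) →
  (∀ c i → dot (f c) (W i) ≡ dot c (V i)) → (∀ c i → dot (g c) (V i) ≡ dot c (W i)) →
  CombEquiv V W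
combEquiv-by-functionals V W f g fW≡ gV≡ = φ′ , ψ′ , ψ′φ′≈id , φ′ψ′≈id , λ F F′ → mono F F′ , reflect F F′
  where
  φ′ : Face V → Face W
  φ′ F = faceOf W (f (normal F)) (level F) λ i →
    subst (_≤ℚ level F) (sym (fW≡ (normal F) i)) (generator-≤ F i)
  ψ′ : Face W → Face V
  ψ′ G = faceOf V (g (normal G)) (level G) λ i →
    subst (_≤ℚ level G) (sym (gV≡ (normal G) i)) (generator-≤ G i)
  ψ′φ′≈id : ∀ F → ψ′ (φ′ F) ≈F F
  ψ′φ′≈id F = ≈F-by-normals (ψ′ (φ′ F)) F refl λ i → trans (gV≡ (f (normal F)) i) (fW≡ (normal F) i)
  φ′ψ′≈id : ∀ G → φ′ (ψ′ G) ≈F G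
  φ′ψ′≈id G = ≈F-by-normals (φ′ (ψ′ G)) G refl λ i → trans (fW≡ (g (normal G)) i) (gV≡ (normal G) i)
  mono : ∀ F F′ → F ⊆F F′ → φ′ F ⊆F φ′ F′
  mono F F′ F⊆F′ y (y∈ , on) = y∈ ,
    trans (dot-reweight V (f (normal F′)) (normal F′) (fW≡ (normal F′)) y∈) (∈F-level F′ (F⊆F′ _ x∈F))
    where x∈F = ∈F-intro F (reweight-conv V y∈)
                  (trans (sym (dot-reweight V (f (normal F)) (normal F) (fW≡ (normal F)) y∈)) on)
  reflect : ∀ F F′ → φ′ F ⊆F φ′ F′ → F ⊆F F′
  reflect F F′ φF⊆φF′ x x∈F = ∈F-intro F′ x∈
    (trans (dot-reweight W (normal F′) (f (normal F′)) (sym ∘ fW≡ (normal F′)) x∈) (proj₂ (φF⊆φF′ _ y∈φF)))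
    where
    x∈ = ∈F-conv F x∈F
    y∈φF = reweight-conv W x∈ ,
      trans (sym (dot-reweight W (normal F) (f (normal F)) (sym ∘ fW≡ (normal F)) x∈)) (∈F-level F x∈F)

applySign : Bool → ℚ → ℚ
applySign true  x = x
applySign false x = - x

applySign-not : ∀ b x → applySign (not b) x ≡ - applySign b x
applySign-not true  x = refl
applySign-not false x = sym (⁻¹-involutive x)

module SignedIndex (s : ℕ) where

  signed : Fin s → Bool → Fin (s ℕ.+ s)
  signed j true  = j ↑ˡ s
  signed j false = s ↑ʳ j

  unsigned : Fin (s ℕ.+ s) → Fin s × Bool
  unsigned i = [ (_, true) , (_, false) ]′ (splitAt s i)

  unsigned-signed : ∀ (j : Fin s) b → unsigned (signed j b) ≡ (j , b)
  unsigned-signed j true  rewrite splitAt-↑ˡ s j s = refl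
  unsigned-signed j false rewrite splitAt-↑ʳ s s j = refl

  signed-unsigned : (i : Fin (s ℕ.+ s)) → signed (proj₁ (unsigned i)) (proj₂ (unsigned i)) ≡ i
  signed-unsigned i = trans (signed-join (splitAt s i)) (join-splitAt s s i)
    where
    signed-join : ∀ x → signed (proj₁ ([ (_, true) , (_, false) ]′ x)) (proj₂ ([ (_, true) , (_, false) ]′ x))
                        ≡ Fin.join s s x
    signed-join (inj₁ j) = refl
    signed-join (inj₂ j) = refl

  signed-elim : (P : Fin (s ℕ.+ s) → Set) → (∀ j b → P (signed j b)) → ∀ i → P i
  signed-elim P P-signed i = subst P (signed-unsigned i) (P-signed (proj₁ (unsigned i)) (proj₂ (unsigned i)))

  antipode : Fin (s ℕ.+ s) → Fin (s ℕ.+ s)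
  antipode i = signed (proj₁ (unsigned i)) (not (proj₂ (unsigned i)))

  antipode-signed : ∀ (j : Fin s) b → antipode (signed j b) ≡ signed j (not b)
  antipode-signed j b = cong (λ u → signed (proj₁ u) (not (proj₂ u))) (unsigned-signed j b)

  ±fam-signed : ∀ {m} (v : Fin s → Pt m) j b r → ±fam v (signed j b) r ≡ applySign b (v j r)
  ±fam-signed v j true  r rewrite splitAt-↑ˡ s j s = refl
  ±fam-signed v j false r rewrite splitAt-↑ʳ s s j = refl

  dot-±fam : ∀ {m} (v : Fin s → Pt m) c j b → dot c (±fam v (signed j b)) ≡ applySign b (dot c (v j))
  dot-±fam v c j true  = dot-congʳ c (±fam-signed v j true)
  dot-±fam v c j false = trans (dot-congʳ c (±fam-signed v j false)) (dot-negʳ c (v j))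

  dot-±fam-antipode : ∀ {m} (v : Fin s → Pt m) c i → dot c (±fam v (antipode i)) ≡ - dot c (±fam v i)
  dot-±fam-antipode v c = signed-elim (λ i → dot c (±fam v (antipode i)) ≡ - dot c (±fam v i)) λ j b → begin
    dot c (±fam v (antipode (signed j b))) ≡⟨ cong (dot c ∘ ±fam v) (antipode-signed j b) ⟩
    dot c (±fam v (signed j (not b)))      ≡⟨ dot-±fam v c j (not b) ⟩
    applySign (not b) (dot c (v j))        ≡⟨ applySign-not b (dot c (v j)) ⟩
    - applySign b (dot c (v j))            ≡⟨ cong -_ (dot-±fam v c j b) ⟨
    - dot c (±fam v (signed j b))          ∎
    where open ≡-Reasoning

  module _ {m} {v : Fin s → Pt m} where

    -- A valid inequality c·x ≤ 0 on a centrally symmetric set forces c·V i = 0 on generators.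
    level≡0⇒improper : (F : Face (±fam v)) → level F ≡ 0ℚ → Improper F
    level≡0⇒improper F h≡0 x x∈ = ∈F-intro F x∈
      (trans (conv-agree (normal F) (λ _ → 0ℚ) on-generators x x∈) (trans (dot-zeroˡ x) (sym h≡0)))
      where
      ≤0 : ∀ i → dot (normal F) (±fam v i) ≤ℚ 0ℚ
      ≤0 i = subst (dot (normal F) (±fam v i) ≤ℚ_) h≡0 (generator-≤ F i)
      on-generators : ∀ i → dot (normal F) (±fam v i) ≡ dot (λ _ → 0ℚ) (±fam v i)
      on-generators i = trans (ℚP.≤-antisym (≤0 i) (subst (0ℚ ≤ℚ_) (⁻¹-involutive _)
          (ℚP.neg-antimono-≤ (subst (_≤ℚ 0ℚ) (dot-±fam-antipode v (normal F) i) (≤0 (antipode i))))))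
        (sym (dot-zeroˡ (±fam v i)))

    antipodal-pair⇒improper : (F : Face (±fam v)) → ∀ i → ±fam v i ∈F F → ±fam v (antipode i) ∈F F → Improper F
    antipodal-pair⇒improper F i i∈F -i∈F = level≡0⇒improper F (p≡-p⇒p≡0 (begin
      level F                                   ≡⟨ ∈F-level F -i∈F ⟨
      dot (normal F) (±fam v (antipode i))      ≡⟨ dot-±fam-antipode v (normal F) i ⟩
      - dot (normal F) (±fam v i)               ≡⟨ cong -_ (∈F-level F i∈F) ⟩
      - level F                                 ∎))
      where open ≡-Reasoning

  AgreesAt : (Fin s → Bool) → Fin s × Bool → Set
  AgreesAt τ (j , b) = τ j ≡ b

  -- The vertex with index i lies on the facet of the crosspolytope with sign pattern τ.
  Agrees : (Fin s → Bool) → Fin (s ℕ.+ s) → Set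
  Agrees τ i = AgreesAt τ (unsigned i)

  agrees? : ∀ (τ : Fin s → Bool) i → Dec (Agrees τ i)
  agrees? τ i = τ (proj₁ (unsigned i)) Bool.≟ proj₂ (unsigned i)

  agrees-signed⁺ : ∀ (τ : Fin s → Bool) j b → τ j ≡ b → Agrees τ (signed j b)
  agrees-signed⁺ τ j b = subst (AgreesAt τ) (sym (unsigned-signed j b))

  agrees-signed⁻ : ∀ (τ : Fin s → Bool) j b → Agrees τ (signed j b) → τ j ≡ b
  agrees-signed⁻ τ j b = subst (AgreesAt τ) (unsigned-signed j b)

  agrees-antipode : ∀ (τ : Fin s → Bool) i → Agrees τ i → ¬ Agrees τ (antipode i)
  agrees-antipode τ i agrees agrees⁻ = not-¬ agrees
    (agrees-signed⁻ τ (proj₁ (unsigned i)) (not (proj₂ (unsigned i))) agrees⁻)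

  common-agreement : ∀ α γ → γ ≢ antipode α → ∃ λ τ → Agrees τ α × Agrees τ γ
  common-agreement = signed-elim (λ α → ∀ γ → γ ≢ antipode α → ∃ λ τ → Agrees τ α × Agrees τ γ) λ j b →
    signed-elim (λ γ → γ ≢ antipode (signed j b) → ∃ λ τ → Agrees τ (signed j b) × Agrees τ γ)
      λ j′ b′ not-antipodal →
        let τ , τj≡b , τj′≡b′ = separate j b j′ b′ λ eq → not-antipodal (trans eq (sym (antipode-signed j b)))
          in τ , agrees-signed⁺ τ j b τj≡b , agrees-signed⁺ τ j′ b′ τj′≡b′
    where
    separate : ∀ (j : Fin s) b j′ b′ → signed j′ b′ ≢ signed j (not b) → ∃ λ τ → τ j ≡ b × τ j′ ≡ b′
    separate j b j′ b′ not-antipodal with j Fin.≟ j′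
    ... | no j≢j′ = (λ k → if does (k Fin.≟ j) then b else b′)
                  , cong (if_then b else b′) (dec-true (j Fin.≟ j) refl)
                  , cong (if_then b else b′) (dec-false (j′ Fin.≟ j) (j≢j′ ∘ sym))
    separate j true  j true  _ | yes refl = (λ _ → true) , refl , refl
    separate j false j false _ | yes refl = (λ _ → false) , refl , refl
    separate j true  j false not-antipodal | yes refl = contradiction refl not-antipodal
    separate j false j true  not-antipodal | yes refl = contradiction refl not-antipodal

  -- τ j records whether π sends +e_j to an index agreeing with t; π-antipode then settles −e_j.
  agreeing-preimages : (π : Fin (s ℕ.+ s) → Fin (s ℕ.+ s)) → (∀ α → π (antipode α) ≡ antipode (π α)) →
                       ∀ t → ∃ λ τ → ∀ α → Agrees t (π α) → Agrees τ α
  agreeing-preimages π π-antipode t = τ , signed-elim (λ α → Agrees t (π α) → Agrees τ α) by-sign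
    where
    τ : Fin s → Bool
    τ j = does (agrees? t (π (signed j true)))
    by-sign : ∀ j b → Agrees t (π (signed j b)) → Agrees τ (signed j b)
    by-sign j true  agrees = agrees-signed⁺ τ j true (dec-true (agrees? t _) agrees)
    by-sign j false agrees = agrees-signed⁺ τ j false (dec-false (agrees? t _) λ agrees⁺ →
      agrees-antipode t _ agrees⁺ (subst (Agrees t)
        (trans (cong π (sym (antipode-signed j true))) (π-antipode (signed j true))) agrees))

signs-≤1 : ∀ b b′ → applySign b′ (applySign b 1ℚ) ≤ℚ 1ℚ
signs-≤1 true  true  = decide-≤
signs-≤1 true  false = decide-≤
signs-≤1 false true  = decide-≤
signs-≤1 false false = decide-≤

signs≡1⇒≡ : ∀ b b′ → applySign b′ (applySign b 1ℚ) ≡ 1ℚ → b ≡ b′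
signs≡1⇒≡ true  true  _  = refl
signs≡1⇒≡ false false _  = refl
signs≡1⇒≡ true  false ()
signs≡1⇒≡ false true  ()

signs-same : ∀ b → applySign b (applySign b 1ℚ) ≡ 1ℚ
signs-same true  = refl
signs-same false = refl

applySign-zero : ∀ b → applySign b 0ℚ ≡ 0ℚ
applySign-zero true  = refl
applySign-zero false = refl

module Crosspolytope (s : ℕ) where
  open SignedIndex s

  private
    E : Fin (s ℕ.+ s) → Pt s
    E = crossVerts s

  dot-cross : ∀ (c : Pt s) j b → dot c (E (signed j b)) ≡ applySign b (c j)
  dot-cross c j b = trans (dot-±fam δ c j b) (cong (applySign b) (dot-δʳ c j))

  cross-inner : ∀ j b j′ b′ → dot (E (signed j b)) (E (signed j′ b′)) ≡ applySign b′ (applySign b (δ j j′))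
  cross-inner j b j′ b′ = trans (dot-cross (E (signed j b)) j′ b′) (cong (applySign b′) (±fam-signed δ j b j′))

  cross-inner-≤1 : ∀ α γ → dot (E α) (E γ) ≤ℚ 1ℚ
  cross-inner-≤1 = signed-elim (λ α → ∀ γ → dot (E α) (E γ) ≤ℚ 1ℚ) λ j b →
    signed-elim (λ γ → dot (E (signed j b)) (E γ) ≤ℚ 1ℚ) λ j′ b′ →
      subst (_≤ℚ 1ℚ) (sym (cross-inner j b j′ b′)) (bound j b j′ b′)
    where
    bound : ∀ (j : Fin s) b j′ b′ → applySign b′ (applySign b (δ j j′)) ≤ℚ 1ℚ
    bound j b j′ b′ with j Fin.≟ j′
    ... | yes refl = signs-≤1 b b′
    ... | no  _    rewrite applySign-zero b | applySign-zero b′ = decide-≤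

  cross-inner≡1⇒≡ : ∀ α γ → dot (E α) (E γ) ≡ 1ℚ → γ ≡ α
  cross-inner≡1⇒≡ = signed-elim (λ α → ∀ γ → dot (E α) (E γ) ≡ 1ℚ → γ ≡ α) λ j b →
    signed-elim (λ γ → dot (E (signed j b)) (E γ) ≡ 1ℚ → γ ≡ signed j b) λ j′ b′ inner≡1 →
      same j b j′ b′ (trans (sym (cross-inner j b j′ b′)) inner≡1)
    where
    same : ∀ (j : Fin s) b j′ b′ → applySign b′ (applySign b (δ j j′)) ≡ 1ℚ → signed j′ b′ ≡ signed j b
    same j b j′ b′ with j Fin.≟ j′
    ... | yes refl = cong (signed j) ∘ sym ∘ signs≡1⇒≡ b b′
    ... | no  _    rewrite applySign-zero b | applySign-zero b′ = λ ()

  cross-inner-self : ∀ α → dot (E α) (E α) ≡ 1ℚ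
  cross-inner-self = signed-elim (λ α → dot (E α) (E α) ≡ 1ℚ) λ j b →
    trans (cross-inner j b j b) (trans (cong (applySign b ∘ applySign b) (δ-refl j)) (signs-same b))

  vertexFace : Fin (s ℕ.+ s) → Face E
  vertexFace α = faceOf E (E α) 1ℚ (cross-inner-≤1 α)

  vertex∈vertexFace : ∀ α → E α ∈F vertexFace α
  vertex∈vertexFace α = generator∈conv E α , cross-inner-self α

  vertexFace-generator : ∀ α γ → E γ ∈F vertexFace α → γ ≡ α
  vertexFace-generator α γ (_ , inner≡1) = cross-inner≡1⇒≡ α γ inner≡1

  signVector : (Fin s → Bool) → Pt s
  signVector τ j = applySign (τ j) 1ℚ

  facet : (Fin s → Bool) → Face E
  facet τ = faceOf E (signVector τ) 1ℚ (signed-elim (λ γ → dot (signVector τ) (E γ) ≤ℚ 1ℚ) λ j b →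
    subst (_≤ℚ 1ℚ) (sym (dot-cross (signVector τ) j b)) (signs-≤1 (τ j) b))

  agrees⇒∈facet : ∀ τ γ → Agrees τ γ → E γ ∈F facet τ
  agrees⇒∈facet τ = signed-elim (λ γ → Agrees τ γ → E γ ∈F facet τ) λ j b agrees →
    generator∈conv E (signed j b) ,
    trans (dot-cross (signVector τ) j b)
      (subst (λ b → applySign b (applySign (τ j) 1ℚ) ≡ 1ℚ) (agrees-signed⁻ τ j b agrees) (signs-same (τ j)))

  ∈facet⇒agrees : ∀ τ γ → E γ ∈F facet τ → Agrees τ γ
  ∈facet⇒agrees τ = signed-elim (λ γ → E γ ∈F facet τ → Agrees τ γ) λ j b (_ , on) →
    agrees-signed⁺ τ j b (signs≡1⇒≡ (τ j) b (trans (sym (dot-cross (signVector τ) j b)) on))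

  vertexFace⊆facet : ∀ τ α → Agrees τ α → vertexFace α ⊆F facet τ
  vertexFace⊆facet τ α agrees = ⊆F-by-generators (vertexFace α) (facet τ) λ γ γ∈ →
    subst (λ γ → E γ ∈F facet τ) (sym (vertexFace-generator α γ γ∈)) (agrees⇒∈facet τ α agrees)

-- Dual bases by Gaussian elimination

LinearlyIndependent : ∀ {s m} → (Fin s → Pt m) → Set
LinearlyIndependent v = ∀ a → (∀ r → lincomb a v r ≡ 0ℚ) → ∀ k → a k ≡ 0ℚ

NontrivialRelation : ∀ {s m} → (Fin s → Pt m) → Set
NontrivialRelation v = ∃ λ a → (∀ r → lincomb a v r ≡ 0ℚ) × ∃ λ k → a k ≢ 0ℚ

DualBasis : ∀ {s m} → (Fin s → Pt m) → Set
DualBasis {s} {m} v = ∃ λ (C : Fin s → Pt m) → ∀ j k → dot (C j) (v k) ≡ δ j k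

module Elimination {s m} (v : Fin (suc s) → Pt m) (r : Fin m) (pivot≢0 : v zero r ≢ 0ℚ) where

  private instance
    pivot-nonZero : ℚ.NonZero (v zero r)
    pivot-nonZero = ℚ.≢-nonZero pivot≢0

  ratio : Fin s → ℚ
  ratio k = v (suc k) r * 1/ v zero r

  reduced : Fin s → Pt m
  reduced k x = v (suc k) x + - (ratio k * v zero x)

  v-suc≡ : ∀ k x → v (suc k) x ≡ reduced k x + ratio k * v zero x
  v-suc≡ k x = solve 3 (λ a b c → a := (a :+ :- (b :* c)) :+ b :* c) refl
    (v (suc k) x) (ratio k) (v zero x)

  relation-lift : NontrivialRelation reduced → NontrivialRelation v
  relation-lift (b , Σb≡0 , k , bk≢0) = a , Σa≡0 , suc k , bk≢0
    where
    S : ℚ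
    S = Σℚ s (λ k → b k * ratio k)
    a : Fin (suc s) → ℚ
    a zero    = - S
    a (suc k) = b k
    Σa≡0 : ∀ x → lincomb a v x ≡ 0ℚ
    Σa≡0 x = begin
      - S * v zero x + Σℚ s (λ k → b k * v (suc k) x)
        ≡⟨ cong (- S * v zero x +_) (trans
             (Σℚ-cong s (λ k → trans (cong (b k *_) (v-suc≡ k x)) (ℚP.*-distribˡ-+ (b k) _ _)))
             (Σℚ-+ s _ _)) ⟩
      - S * v zero x + (lincomb b reduced x + Σℚ s (λ k → b k * (ratio k * v zero x)))
        ≡⟨ cong₂ (λ y z → - S * v zero x + (y + z)) (Σb≡0 x) (trans
             (Σℚ-cong s (λ k → sym (ℚP.*-assoc (b k) (ratio k) (v zero x))))
             (Σℚ-*ʳ s (v zero x) _)) ⟩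
      - S * v zero x + (0ℚ + S * v zero x)
        ≡⟨ solve 2 (λ S y → (:- S) :* y :+ (con 0ℚ :+ S :* y) := con 0ℚ) refl S (v zero x) ⟩
      0ℚ ∎
      where open ≡-Reasoning

  private
    x-x*1≡0 : ∀ x → x + - (x * 1ℚ) ≡ 0ℚ
    x-x*1≡0 = solve 1 (λ x → x :+ :- (x :* con 1ℚ) := con 0ℚ) refl

    x-y*0≡x : ∀ x y → x + - (y * 0ℚ) ≡ x
    x-y*0≡x x y = trans (cong (λ z → x + - z) (ℚP.*-zeroʳ y)) (ℚP.+-identityʳ x)

  pivotFunctional : Pt m
  pivotFunctional x = 1/ v zero r * δ r x

  dot-pivotFunctional : ∀ u → dot pivotFunctional u ≡ 1/ v zero r * u r
  dot-pivotFunctional u = trans (dot-*ˡ (1/ v zero r) (δ r) u) (cong (1/ v zero r *_) (Σℚ-δˡ m r u))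

  pivotFunctional-v₀ : dot pivotFunctional (v zero) ≡ 1ℚ
  pivotFunctional-v₀ = trans (dot-pivotFunctional (v zero)) (ℚP.*-inverseˡ (v zero r))

  pivotFunctional-v : ∀ k → dot pivotFunctional (v (suc k)) ≡ ratio k
  pivotFunctional-v k = trans (dot-pivotFunctional (v (suc k))) (ℚP.*-comm (1/ v zero r) (v (suc k) r))

  pivotFunctional-reduced : ∀ k → dot pivotFunctional (reduced k) ≡ 0ℚ
  pivotFunctional-reduced k = begin
    dot pivotFunctional (reduced k)
      ≡⟨ dot-minus-scaledʳ (ratio k) pivotFunctional _ _ ⟩
    dot pivotFunctional (v (suc k)) + - (ratio k * dot pivotFunctional (v zero))
      ≡⟨ cong₂ (λ y z → y + - (ratio k * z)) (pivotFunctional-v k) pivotFunctional-v₀ ⟩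
    ratio k + - (ratio k * 1ℚ)
      ≡⟨ x-x*1≡0 (ratio k) ⟩
    0ℚ ∎
    where open ≡-Reasoning

  dualBasis-lift : DualBasis reduced → DualBasis v
  dualBasis-lift (D , D-dual) = C , C-dual
    where
    f = pivotFunctional
    d₀ : Fin s → ℚ
    d₀ k = dot (D k) (v zero)
    -- D k corrected so as to vanish on v₀
    D₀ : Fin s → Pt m
    D₀ k x = D k x + - (d₀ k * f x)
    D₀-v₀ : ∀ k → dot (D₀ k) (v zero) ≡ 0ℚ
    D₀-v₀ k = begin
      dot (D₀ k) (v zero)                  ≡⟨ dot-minus-scaledˡ (d₀ k) (D k) f (v zero) ⟩
      d₀ k + - (d₀ k * dot f (v zero))     ≡⟨ cong (λ y → d₀ k + - (d₀ k * y)) pivotFunctional-v₀ ⟩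
      d₀ k + - (d₀ k * 1ℚ)                 ≡⟨ x-x*1≡0 (d₀ k) ⟩
      0ℚ                                   ∎
      where open ≡-Reasoning
    D₀-v : ∀ k l → dot (D₀ k) (v (suc l)) ≡ δ k l
    D₀-v k l = begin
      dot (D₀ k) (v (suc l))
        ≡⟨ dot-congʳ (D₀ k) (v-suc≡ l) ⟩
      dot (D₀ k) (λ x → reduced l x + ratio l * v zero x)
        ≡⟨ dot-+ʳ (D₀ k) (reduced l) _ ⟩
      dot (D₀ k) (reduced l) + dot (D₀ k) (λ x → ratio l * v zero x)
        ≡⟨ cong₂ _+_ (dot-minus-scaledˡ (d₀ k) (D k) f (reduced l)) (dot-*ʳ (ratio l) (D₀ k) (v zero)) ⟩
      (dot (D k) (reduced l) + - (d₀ k * dot f (reduced l))) + ratio l * dot (D₀ k) (v zero)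
        ≡⟨ cong₂ (λ y z → (y + - (d₀ k * z)) + ratio l * dot (D₀ k) (v zero))
             (D-dual k l) (pivotFunctional-reduced l) ⟩
      (δ k l + - (d₀ k * 0ℚ)) + ratio l * dot (D₀ k) (v zero)
        ≡⟨ cong₂ _+_ (x-y*0≡x (δ k l) (d₀ k)) (cong (ratio l *_) (D₀-v₀ k)) ⟩
      δ k l + ratio l * 0ℚ
        ≡⟨ cong (δ k l +_) (ℚP.*-zeroʳ (ratio l)) ⟩
      δ k l + 0ℚ
        ≡⟨ ℚP.+-identityʳ (δ k l) ⟩
      δ k l ∎
      where open ≡-Reasoning
    -- f corrected so as to vanish on v₁, …, v_s
    f₀ : Pt m
    f₀ x = f x + - lincomb ratio D₀ x
    dot-f₀ : ∀ u → dot f₀ u ≡ dot f u + - Σℚ s (λ l → ratio l * dot (D₀ l) u)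
    dot-f₀ u = trans (dot-+ˡ f _ u) (cong (dot f u +_)
      (trans (dot-negˡ (lincomb ratio D₀) u) (cong -_ (dot-lincombˡ ratio D₀ u))))
    f₀-v₀ : dot f₀ (v zero) ≡ 1ℚ
    f₀-v₀ = trans (dot-f₀ (v zero)) (cong₂ (λ y z → y + - z) pivotFunctional-v₀
      (trans (Σℚ-cong s (λ l → trans (cong (ratio l *_) (D₀-v₀ l)) (ℚP.*-zeroʳ (ratio l)))) (Σℚ-zero s)))
    f₀-v : ∀ k → dot f₀ (v (suc k)) ≡ 0ℚ
    f₀-v k = trans (dot-f₀ (v (suc k))) (trans (cong₂ (λ y z → y + - z) (pivotFunctional-v k)
      (trans (Σℚ-cong s (λ l → cong (ratio l *_) (trans (D₀-v l k) (δ-sym l k)))) (Σℚ-δʳ s k ratio)))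
      (ℚP.+-inverseʳ (ratio k)))
    C : Fin (suc s) → Pt m
    C zero    = f₀
    C (suc k) = D₀ k
    C-dual : ∀ j k → dot (C j) (v k) ≡ δ j k
    C-dual zero    zero    = f₀-v₀
    C-dual zero    (suc k) = f₀-v k
    C-dual (suc j) zero    = D₀-v₀ j
    C-dual (suc j) (suc k) = D₀-v j k

relation-or-dualBasis : ∀ {s m} (v : Fin s → Pt m) → NontrivialRelation v ⊎ DualBasis v
relation-or-dualBasis {zero}  v = inj₂ ((λ ()) , λ ())
relation-or-dualBasis {suc s} v with any? (λ r → ¬? (v zero r ℚP.≟ 0ℚ))
... | yes (r , pivot≢0) = Sum.map relation-lift dualBasis-lift (relation-or-dualBasis reduced)
  where open Elimination v r pivot≢0
... | no  no-pivot = inj₁ (δ zero , v₀-relation , zero , λ ())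
  where
  v₀-relation : ∀ x → lincomb (δ zero) v x ≡ 0ℚ
  v₀-relation x = trans (Σℚ-δˡ (suc s) zero (λ k → v k x))
    (decidable-stable (v zero x ℚP.≟ 0ℚ) (λ v₀x≢0 → no-pivot (x , v₀x≢0)))

independent⇒dualBasis : ∀ {s m} (v : Fin s → Pt m) → LinearlyIndependent v → DualBasis v
independent⇒dualBasis v independent with relation-or-dualBasis v
... | inj₁ (a , Σa≡0 , k , ak≢0) = contradiction (independent a Σa≡0 k) ak≢0
... | inj₂ dual                  = dual

dualBasis⇒crosspolytope : ∀ {s m} (v : Fin s → Pt m) → DualBasis v → IsCrosspolytope s (±fam v)
dualBasis⇒crosspolytope {s} v (C , C-dual) =
  combEquiv-by-functionals (±fam v) (crossVerts s) (λ c k → dot c (v k)) (λ e → lincomb e C) values values′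
  where
  open SignedIndex s
  open Crosspolytope s
  values : ∀ c i → dot (λ k → dot c (v k)) (crossVerts s i) ≡ dot c (±fam v i)
  values c = signed-elim _ λ j b → trans (dot-cross (λ k → dot c (v k)) j b) (sym (dot-±fam v c j b))
  values′ : ∀ e i → dot (lincomb e C) (±fam v i) ≡ dot e (crossVerts s i)
  values′ e = signed-elim _ λ j b → begin
    dot (lincomb e C) (±fam v (signed j b))            ≡⟨ dot-±fam v (lincomb e C) j b ⟩
    applySign b (dot (lincomb e C) (v j))              ≡⟨ cong (applySign b) (dot-lincombˡ e C (v j)) ⟩
    applySign b (Σℚ s (λ k → e k * dot (C k) (v j)))   ≡⟨ cong (applySign b) (Σℚ-cong s λ k →
                                                            cong (e k *_) (trans (C-dual k j) (δ-sym k j))) ⟩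
    applySign b (Σℚ s (λ k → e k * δ j k))             ≡⟨ cong (applySign b) (Σℚ-δʳ s j e) ⟩
    applySign b (e j)                                  ≡⟨ dot-cross e j b ⟨
    dot e (crossVerts s (signed j b))                  ∎
    where open ≡-Reasoning

signOf : ℚ → Bool
signOf x = does (0ℚ ℚP.≤? x)

0≤applySign-signOf : ∀ x → 0ℚ ≤ℚ applySign (signOf x) x
0≤applySign-signOf x = by-cases (0ℚ ℚP.≤? x)
  where
  by-cases : (0≤x? : Dec (0ℚ ≤ℚ x)) → 0ℚ ≤ℚ applySign (does 0≤x?) x
  by-cases (yes 0≤x) = 0≤x
  by-cases (no  0≰x) = ℚP.neg-antimono-≤ (ℚP.<⇒≤ (ℚP.≰⇒> 0≰x))

applySign≡0 : ∀ b {x} → applySign b x ≡ 0ℚ → x ≡ 0ℚ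
applySign≡0 true  ±x≡0 = ±x≡0
applySign≡0 false ±x≡0 = trans (sym (⁻¹-involutive _)) (cong -_ ±x≡0)

applySign-*-applySign : ∀ b x y → applySign b x * applySign b y ≡ x * y
applySign-*-applySign true  x y = refl
applySign-*-applySign false x y = solve 2 (λ x y → (:- x) :* (:- y) := x :* y) refl x y

module _ {s m} (v : Fin s → Pt m) where
  open SignedIndex s

  SignedFace : (Fin s → Bool) → Face (±fam v) → Set
  SignedFace t F = (∀ k → ±fam v (signed k (t k)) ∈F F) × (∀ k → ¬ ±fam v (signed k (not (t k))) ∈F F)

  -- If a relation Σ a k v k = 0 were nontrivial, the face containing all (sign a k) v k
  -- would contain their barycentre 0 (weights ∣a k∣), hence have level 0 and be improper.
  signedFaces⇒independent : (∀ t → ∃ (SignedFace t)) → LinearlyIndependent v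
  signedFaces⇒independent signedFace a Σa≡0 k₀ with a k₀ ℚP.≟ 0ℚ
  ... | yes ak₀≡0 = ak₀≡0
  ... | no  ak₀≢0 = ⊥-elim (avoids k₀ (level≡0⇒improper F level≡0 _ (generator∈conv (±fam v) _)))
    where
    t : Fin s → Bool
    t k = signOf (a k)
    F = proj₁ (signedFace t)
    contains = proj₁ (proj₂ (signedFace t))
    avoids = proj₂ (proj₂ (signedFace t))
    ∣a∣ : Fin s → ℚ
    ∣a∣ k = applySign (t k) (a k)
    term : ∀ k → a k * dot (normal F) (v k) ≡ ∣a∣ k * level F
    term k = begin
      a k * dot (normal F) (v k)
        ≡⟨ applySign-*-applySign (t k) (a k) _ ⟨
      ∣a∣ k * applySign (t k) (dot (normal F) (v k))
        ≡⟨ cong (∣a∣ k *_) (dot-±fam v (normal F) k (t k)) ⟨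
      ∣a∣ k * dot (normal F) (±fam v (signed k (t k)))
        ≡⟨ cong (∣a∣ k *_) (∈F-level F (contains k)) ⟩
      ∣a∣ k * level F ∎
      where open ≡-Reasoning
    Σ∣a∣·level≡0 : Σℚ s ∣a∣ * level F ≡ 0ℚ
    Σ∣a∣·level≡0 = begin
      Σℚ s ∣a∣ * level F                            ≡⟨ Σℚ-*ʳ s (level F) ∣a∣ ⟨
      Σℚ s (λ k → ∣a∣ k * level F)                  ≡⟨ Σℚ-cong s (sym ∘ term) ⟩
      Σℚ s (λ k → a k * dot (normal F) (v k))       ≡⟨ dot-lincombʳ (normal F) a v ⟨
      dot (normal F) (lincomb a v)                  ≡⟨ dot-congʳ (normal F) Σa≡0 ⟩
      dot (normal F) (λ _ → 0ℚ)                     ≡⟨ dot-zeroʳ (normal F) ⟩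
      0ℚ                                            ∎
      where open ≡-Reasoning
    Σ∣a∣≢0 : Σℚ s ∣a∣ ≢ 0ℚ
    Σ∣a∣≢0 Σ≡0 = ak₀≢0 (applySign≡0 (t k₀)
      (Σℚ-nonNeg≡0⇒≡0 s (λ k → 0≤applySign-signOf (a k)) Σ≡0 k₀))
    level≡0 : level F ≡ 0ℚ
    level≡0 = p*q≡0⇒p≡0 (trans (ℚP.*-comm (level F) (Σℚ s ∣a∣)) Σ∣a∣·level≡0) Σ∣a∣≢0

injective⇒surjective : ∀ {n} {f : Fin n → Fin n} → Injective _≡_ _≡_ f → ∀ y → ∃ λ x → f x ≡ y
injective⇒surjective {suc n} {f} f-injective y with any? (λ x → f x Fin.≟ y)
... | yes hit  = hit
... | no  miss = contradiction (injective⇒≤ f-punchOut-injective) ℕP.1+n≰n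
  where
  f-punchOut : Fin (suc n) → Fin n
  f-punchOut x = punchOut {i = y} λ y≡fx → miss (x , sym y≡fx)
  f-punchOut-injective : Injective _≡_ _≡_ f-punchOut
  f-punchOut-injective same = f-injective (punchOut-injective {i = y} _ _ same)

module _ {s m} {v : Fin s → Pt m} (iso : IsCrosspolytope s (±fam v)) where
  open SignedIndex s
  open Crosspolytope s

  private
    V = ±fam v
    E = crossVerts s

  opaque
    -- Plays the role of the vertex of conv(±v) corresponding to α.
    vertexImage : Fin (s ℕ.+ s) → Fin (s ℕ.+ s)
    vertexImage α = proj₁ (ψ-generator iso (vertexFace α) (vertex∈vertexFace α))

    vertexImage∈ : ∀ α → V (vertexImage α) ∈F ψ iso (vertexFace α)
    vertexImage∈ α = proj₂ (ψ-generator iso (vertexFace α) (vertex∈vertexFace α))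

  -- If α and β share their image, φ of the meet of both image faces contains a vertex γ
  -- lying in vertexFace α and in vertexFace β, so α = γ = β.
  vertexImage-injective : Injective _≡_ _≡_ vertexImage
  vertexImage-injective {α} {β} same = trans (sym (witness≡ α (∩F-⊆ˡ Fα Fβ))) (witness≡ β (∩F-⊆ʳ Fα Fβ))
    where
    Fα Fβ : Face V
    Fα = ψ iso (vertexFace α)
    Fβ = ψ iso (vertexFace β)
    witness : ∃ λ γ → E γ ∈F φ iso (Fα ∩F Fβ)
    witness = φ-generator iso (Fα ∩F Fβ) (∈∩F Fα Fβ (vertexImage∈ α)
      (subst (λ i → V i ∈F Fβ) (sym same) (vertexImage∈ β)))
    witness≡ : ∀ δ′ → (Fα ∩F Fβ) ⊆F ψ iso (vertexFace δ′) → proj₁ witness ≡ δ′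
    witness≡ δ′ ∩⊆ = vertexFace-generator δ′ (proj₁ witness)
      (proj₁ (φ∘ψ≈id iso (vertexFace δ′)) (E (proj₁ witness))
        (φ-mono iso (Fα ∩F Fβ) (ψ iso (vertexFace δ′)) ∩⊆ (E (proj₁ witness)) (proj₂ witness)))

  vertexImage-surjective : ∀ i → ∃ λ α → vertexImage α ≡ i
  vertexImage-surjective = injective⇒surjective vertexImage-injective

  vertexImage∈ψfacet : ∀ τ α → Agrees τ α → V (vertexImage α) ∈F ψ iso (facet τ)
  vertexImage∈ψfacet τ α agrees = ψ-mono iso _ _ (vertexFace⊆facet τ α agrees) _ (vertexImage∈ α)

  ψfacet-proper : ∀ τ α → Agrees τ α → ¬ Improper (ψ iso (facet τ))
  ψfacet-proper τ α agrees improper = agrees-antipode τ α agrees (∈facet⇒agrees τ (antipode α)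
    (ψ-improper iso (facet τ) improper _ (generator∈conv E (antipode α))))

  images-not-antipodal : ∀ α γ → γ ≢ antipode α → vertexImage γ ≢ antipode (vertexImage α)
  images-not-antipodal α γ γ≢-α γ↦ =
    let τ , τα , τγ = common-agreement α γ γ≢-α
        F = ψ iso (facet τ)
    in ψfacet-proper τ α τα (antipodal-pair⇒improper F (vertexImage α) (vertexImage∈ψfacet τ α τα)
         (subst (λ i → V i ∈F F) γ↦ (vertexImage∈ψfacet τ γ τγ)))

  vertexImage-antipode : ∀ α → vertexImage (antipode α) ≡ antipode (vertexImage α)
  vertexImage-antipode α = by-cases (vertexImage-surjective (antipode (vertexImage α)))
    where
    by-cases : (∃ λ γ → vertexImage γ ≡ antipode (vertexImage α)) →
               vertexImage (antipode α) ≡ antipode (vertexImage α)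
    by-cases (γ , γ↦) with γ Fin.≟ antipode α
    ... | yes refl  = γ↦
    ... | no  γ≢-α = contradiction γ↦ (images-not-antipodal α γ γ≢-α)

  ψfacet-signed : ∀ t τ → (∀ α → Agrees t (vertexImage α) → Agrees τ α) → SignedFace v t (ψ iso (facet τ))
  ψfacet-signed t τ preimages-agree = contains , avoids
    where
    F = ψ iso (facet τ)
    preimage : ∀ k → ∃ λ α → vertexImage α ≡ signed k (t k)
    preimage k = vertexImage-surjective (signed k (t k))
    preimage-agrees : ∀ k → Agrees τ (proj₁ (preimage k))
    preimage-agrees k = preimages-agree (proj₁ (preimage k))
      (subst (Agrees t) (sym (proj₂ (preimage k))) (agrees-signed⁺ t k (t k) refl))
    contains : ∀ k → V (signed k (t k)) ∈F F
    contains k = subst (λ i → V i ∈F F) (proj₂ (preimage k))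
      (vertexImage∈ψfacet τ (proj₁ (preimage k)) (preimage-agrees k))
    avoids : ∀ k → ¬ V (signed k (not (t k))) ∈F F
    avoids k opposite∈F = ψfacet-proper τ (proj₁ (preimage k)) (preimage-agrees k)
      (antipodal-pair⇒improper F (signed k (t k)) (contains k)
        (subst (λ i → V i ∈F F) (sym (antipode-signed k (t k))) opposite∈F))

  signedFaces : ∀ t → ∃ (SignedFace v t)
  signedFaces t =
    let τ , preimages-agree = agreeing-preimages vertexImage vertexImage-antipode t
    in ψ iso (facet τ) , ψfacet-signed t τ preimages-agree

crosspolytope⇒independent : ∀ {s m} (v : Fin s → Pt m) → IsCrosspolytope s (±fam v) → LinearlyIndependent v
crosspolytope⇒independent v iso = signedFaces⇒independent v (signedFaces iso)

fromℤ : ℤ → ℚ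
fromℤ i = i ℚ./ 1

private
  fromℤ≡mkℚ : ∀ i → fromℤ i ≡ ℚ.mkℚ i 0 (Coprimality.sym (Coprimality.1-coprimeTo _))
  fromℤ≡mkℚ i = ℚP.↥p/↧p≡p (ℚ.mkℚ i 0 (Coprimality.sym (Coprimality.1-coprimeTo _)))

  /-cross : ∀ a b d e → a ℤ.* ℤ.+ suc e ≡ b ℤ.* ℤ.+ suc d → a ℚ./ suc d ≡ b ℚ./ suc e
  /-cross a b d e cross≡ = ℚP.fromℚᵘ-cong {ℚᵘ.mkℚᵘ a d} {ℚᵘ.mkℚᵘ b e} (ℚᵘ.*≡* cross≡)

fromℤ-+ : ∀ i j → fromℤ (i ℤ.+ j) ≡ fromℤ i + fromℤ j
fromℤ-+ i j rewrite fromℤ≡mkℚ i | fromℤ≡mkℚ j =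
  /-cross (i ℤ.+ j) (i ℤ.* ℤ.1ℤ ℤ.+ j ℤ.* ℤ.1ℤ) 0 0 (trans (ℤP.*-identityʳ (i ℤ.+ j))
    (sym (trans (ℤP.*-identityʳ _) (cong₂ ℤ._+_ (ℤP.*-identityʳ i) (ℤP.*-identityʳ j)))))

fromℤ-* : ∀ i j → fromℤ (i ℤ.* j) ≡ fromℤ i * fromℤ j
fromℤ-* i j rewrite fromℤ≡mkℚ i | fromℤ≡mkℚ j = /-cross (i ℤ.* j) (i ℤ.* j) 0 0 refl

fromℤ≡0⇒≡0 : ∀ {i} → fromℤ i ≡ 0ℚ → i ≡ 0ℤ
fromℤ≡0⇒≡0 {i} i≡0 = cong ℚ.↥_ (trans (sym (fromℤ≡mkℚ i)) i≡0)

fromℤ-Σℤ : ∀ k (f : Fin k → ℤ) → fromℤ (Σℤ k f) ≡ Σℚ k (fromℤ ∘ f)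
fromℤ-Σℤ zero    f = refl
fromℤ-Σℤ (suc k) f = trans (fromℤ-+ (f zero) _) (cong (fromℤ (f zero) +_) (fromℤ-Σℤ k (f ∘ suc)))

denominator*≡numerator : ∀ p → fromℤ (ℚ.↧ p) * p ≡ fromℤ (ℚ.↥ p)
denominator*≡numerator p@(ℚ.mkℚ n d-1 _) rewrite fromℤ≡mkℚ (ℚ.↧ p) =
  /-cross (ℚ.↧ p ℤ.* n) n (d-1 ℕ.+ 0) 0 (begin
    ℚ.↧ p ℤ.* n ℤ.* ℤ.1ℤ        ≡⟨ ℤP.*-identityʳ (ℚ.↧ p ℤ.* n) ⟩
    ℚ.↧ p ℤ.* n                 ≡⟨ ℤP.*-comm (ℚ.↧ p) n ⟩
    n ℤ.* ℚ.↧ p                 ≡⟨ cong (λ d → n ℤ.* ℤ.+ suc d) (sym (ℕP.+-identityʳ d-1)) ⟩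
    n ℤ.* ℤ.+ suc (d-1 ℕ.+ 0)   ∎)
  where open ≡-Reasoning

clearDenominators : ∀ s (a : Fin s → ℚ) →
                    ∃ λ D → D ≢ 0ℤ × ∃ λ (z : Fin s → ℤ) → ∀ k → fromℤ (z k) ≡ fromℤ D * a k
clearDenominators zero    a = ℤ.1ℤ , (λ ()) , (λ ()) , λ ()
clearDenominators (suc s) a with clearDenominators s (a ∘ suc)
... | D , D≢0 , z , z≡ = D ℤ.* q , D*q≢0 , z′ , z′≡
  where
  q = ℚ.↧ (a zero)
  D*q≢0 : D ℤ.* q ≢ 0ℤ
  D*q≢0 Dq≡0 = Sum.[ D≢0 , (λ ()) ]′ (ℤP.i*j≡0⇒i≡0∨j≡0 D Dq≡0)
  z′ : Fin (suc s) → ℤ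
  z′ zero    = D ℤ.* ℚ.↥ (a zero)
  z′ (suc k) = q ℤ.* z k
  z′≡ : ∀ k → fromℤ (z′ k) ≡ fromℤ (D ℤ.* q) * a k
  z′≡ zero = begin
    fromℤ (D ℤ.* ℚ.↥ (a zero))        ≡⟨ fromℤ-* D (ℚ.↥ (a zero)) ⟩
    fromℤ D * fromℤ (ℚ.↥ (a zero))    ≡⟨ cong (fromℤ D *_) (denominator*≡numerator (a zero)) ⟨
    fromℤ D * (fromℤ q * a zero)      ≡⟨ ℚP.*-assoc (fromℤ D) (fromℤ q) (a zero) ⟨
    fromℤ D * fromℤ q * a zero        ≡⟨ cong (_* a zero) (fromℤ-* D q) ⟨
    fromℤ (D ℤ.* q) * a zero          ∎
    where open ≡-Reasoning
  z′≡ (suc k) = begin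
    fromℤ (q ℤ.* z k)                 ≡⟨ fromℤ-* q (z k) ⟩
    fromℤ q * fromℤ (z k)             ≡⟨ cong (fromℤ q *_) (z≡ k) ⟩
    fromℤ q * (fromℤ D * a (suc k))   ≡⟨ solve 3 (λ x y w → x :* (y :* w) := (y :* x) :* w) refl
                                           (fromℤ q) (fromℤ D) (a (suc k)) ⟩
    fromℤ D * fromℤ q * a (suc k)     ≡⟨ cong (_* a (suc k)) (fromℤ-* D q) ⟨
    fromℤ (D ℤ.* q) * a (suc k)       ∎
    where open ≡-Reasoning

module _ {m s} (M : Fin m → Fin s → ℤ) where

  columns : Fin s → Pt m
  columns c r = fromℤ (M r c)

  Injectiveℤ : Set
  Injectiveℤ = ∀ (z : Fin s → ℤ) → (∀ r → Σℤ s (λ c → M r c ℤ.* z c) ≡ 0ℤ) → ∀ c → z c ≡ 0ℤ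

  fromℤ-matrix-vector : ∀ (z : Fin s → ℤ) r → fromℤ (Σℤ s (λ c → M r c ℤ.* z c)) ≡ lincomb (fromℤ ∘ z) columns r
  fromℤ-matrix-vector z r = trans (fromℤ-Σℤ s _)
    (Σℚ-cong s λ c → trans (fromℤ-* (M r c) (z c)) (ℚP.*-comm (fromℤ (M r c)) (fromℤ (z c))))

  independent⇒injectiveℤ : LinearlyIndependent columns → Injectiveℤ
  independent⇒injectiveℤ independent z Mz≡0 c = fromℤ≡0⇒≡0
    (independent (fromℤ ∘ z) (λ r → trans (sym (fromℤ-matrix-vector z r)) (cong fromℤ (Mz≡0 r))) c)

  injectiveℤ⇒independent : Injectiveℤ → LinearlyIndependent columns
  injectiveℤ⇒independent injective a Σa≡0 k with clearDenominators s a
  ... | D , D≢0 , z , z≡ = p*q≡0⇒p≡0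
    (trans (ℚP.*-comm (a k) (fromℤ D)) (trans (sym (z≡ k)) (cong fromℤ (injective z Mz≡0 k))))
    (D≢0 ∘ fromℤ≡0⇒≡0)
    where
    Mz≡0 : ∀ r → Σℤ s (λ c → M r c ℤ.* z c) ≡ 0ℤ
    Mz≡0 r = fromℤ≡0⇒≡0 (begin
      fromℤ (Σℤ s (λ c → M r c ℤ.* z c))             ≡⟨ fromℤ-matrix-vector z r ⟩
      Σℚ s (λ c → fromℤ (z c) * columns c r)         ≡⟨ Σℚ-cong s (λ c → trans (cong (_* columns c r) (z≡ c))
                                                          (ℚP.*-assoc (fromℤ D) (a c) (columns c r))) ⟩
      Σℚ s (λ c → fromℤ D * (a c * columns c r))     ≡⟨ Σℚ-*ˡ s (fromℤ D) _ ⟩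
      fromℤ D * lincomb a columns r                  ≡⟨ cong (fromℤ D *_) (Σa≡0 r) ⟩
      fromℤ D * 0ℚ                                   ≡⟨ ℚP.*-zeroʳ (fromℤ D) ⟩
      0ℚ                                             ∎)
      where open ≡-Reasoning

Σℤ-empty : ∀ k → k ≡ 0 → (f : Fin k → ℤ) → Σℤ k f ≡ 0ℤ
Σℤ-empty zero refl f = refl

module _ {n} (Δ : SimplicialComplex n) (d : ℕ) (dimΔ : HasDim Δ d) where

  no-faces-above-dim : fnum Δ (suc d) ≡ 0
  no-faces-above-dim = cong length (filter-none (λ σ → length σ ℕ.≟ suc (suc d))
    (All.map (λ σ≤1+d σ≡2+d → ℕP.<-irrefl refl (subst (ℕ._≤ suc d) σ≡2+d σ≤1+d)) (proj₁ dimΔ)))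

  HdZero⇔injectiveℤ : HdZero Δ d ⇔ Injectiveℤ (∂ Δ d)
  HdZero⇔injectiveℤ = mk⇔
    (λ Hd≡0 z ∂z≡0 c → trans (sym (proj₂ (Hd≡0 z ∂z≡0) c)) (Σℤ-empty _ no-faces-above-dim _))
    (λ injective z ∂z≡0 → (λ _ → 0ℤ) , λ r →
      trans (Σℤ-empty _ no-faces-above-dim _) (sym (injective z ∂z≡0 r)))

corollary5p2 : ∀ {n : ℕ} (Δ : SimplicialComplex n) (d : ℕ) → 1 ≤ d → HasDim Δ d →
    IsCrosspolytope (fnum Δ d) (PΔverts Δ d) ⇔ HdZero Δ d
corollary5p2 Δ d _ dimΔ = mk⇔
  (λ crosspolytope → from Hd⇔ (independent⇒injectiveℤ ∂d
    (crosspolytope⇒independent (columns ∂d) crosspolytope)))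
  (λ Hd≡0 → dualBasis⇒crosspolytope (columns ∂d)
    (independent⇒dualBasis (columns ∂d) (injectiveℤ⇒independent ∂d (to Hd⇔ Hd≡0))))
  where
  open Equivalence
  ∂d = ∂ Δ d
  Hd⇔ = HdZero⇔injectiveℤ Δ d dimΔ
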